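{- For all $w_1,w_2\in\mathfrak{h}^1_{>0}$ we have $s_{w_1}a_{w_2}=a_{d_q(w_1)\circledast_q w_2}$ in $\mathcal{R}^{\mathbb{N}}$.
   Context: Let $\hbar$ be an indeterminate and $\mathcal{C}=\mathbb{Q}[\hbar]$. Let $\mathfrak{h}^1$ be the non-commutative polynomial algebra over $\mathcal{C}$ freely generated by letters $z_1,z_2,\dots$; juxtaposition is concatenation, words are monomials $z_{k_1}\cdots z_{k_r}$ ($r\ge0$, empty word $1$); $\mathfrak{h}^1_{>0}$ is the $\mathcal{C}$-span of nonempty words. Let $z_i\circ_+z_j=z_{i+j}+\hbar z_{i+j-1}$ and let letters act on $\mathfrak{h}^1$ by $z_i\circ_+1=0$, $z_i\circ_+(z_jw)=(z_i\circ_+z_j)w$ ($\mathcal{C}$-bilinear). The $\mathcal{C}$-bilinear product $*_+$ on $\mathfrak{h}^1$: $1*_+w=w*_+1=w$, $(z_iw_1)*_+(z_jw_2)=z_i(w_1*_+z_jw_2)+z_j(z_iw_1*_+w_2)+(z_i\circ_+z_j)(w_1*_+w_2)$. The $\mathcal{C}$-bilinear product $\circledast_q$ on $\mathfrak{h}^1_{>0}$: $(z_iw_1)\circledast_q(z_jw_2)=z_{i+j}(w_1*_+w_2)$ for $i,j\ge1$, $w_1,w_2\in\mathfrak{h}^1$. The $\mathcal{C}$-linear map $d_q$: $d_q(1)=1$, $d_q(z_iw)=z_i\,d_q(w)+z_i\circ_+d_q(w)$. Let $\mathcal{R}=\mathbb{Q}[[q]]$ with $\hbar$ acting as multiplication by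 $1-q$, $\mathcal{R}^{\mathbb{N}}$ the algebra of sequences $(b(n))_{n\ge0}$ in $\mathcal{R}$ with termwise product, $[m]=(1-q^m)/(1-q)$. For a word $u=z_{k_1}\cdots z_{k_r}$ with $r\ge1$ and $n\ge0$ define $s_u(n)=\sum_{n+1=m_1\ge m_2\ge\dots\ge m_r\ge1}\frac{q^{k_1m_1+(k_2-1)m_2+\dots+(k_r-1)m_r}}{[m_1]^{k_1}\cdots[m_r]^{k_r}}$ and $a_u(n)=\sum_{n+1=m_1>m_2>\dots>m_r>0}\frac{q^{(k_1-1)m_1+\dots+(k_r-1)m_r}}{[m_1]^{k_1}\cdots[m_r]^{k_r}}$, extended $\mathcal{C}$-linearly to maps $\mathfrak{h}^1_{>0}\to\mathcal{R}^{\mathbb{N}}$. -}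

module Defs where

open import Data.Nat using (ℕ; zero; suc; _∸_; _≡ᵇ_; _<ᵇ_) renaming (_+_ to _+ℕ_; _*_ to _*ℕ_)
open import Data.Bool using (if_then_else_)
open import Data.Rational using (ℚ; 0ℚ; 1ℚ) renaming (_+_ to _+ℚ_; _*_ to _*ℚ_; -_ to -ℚ_)
open import Data.List using (List; []; _∷_; map; _++_; concatMap)
open import Data.Product using (_×_; _,_)

-- Coefficient ring  C = ℚ[ħ]  (polynomials as coefficient lists, lowest degree first)

C : Set
C = List ℚ

_+C_ : C → C → C
[] +C q = q
(a ∷ p) +C [] = a ∷ p
(a ∷ p) +C (b ∷ q) = (a +ℚ b) ∷ (p +C q)

_*C_ : C → C → C
[] *C q = []
(a ∷ p) *C q = map (a *ℚ_) q +C (0ℚ ∷ (p *C q))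

1C : C
1C = 1ℚ ∷ []

ħ : C
ħ = 0ℚ ∷ 1ℚ ∷ []

-- Letters and words.  The letter  z₁₊ k  stands for  z_{k+1}  (so the
-- letters z₁₊ 0, z₁₊ 1, ... are z_1, z_2, ...).

data Letter : Set where
  z₁₊ : ℕ → Letter

idx : Letter → ℕ
idx (z₁₊ k) = suc k

Word : Set
Word = List Letter

Word⁺ : Set
Word⁺ = Letter × Word

-- elements of 𝔥¹ : finite C-linear combinations of words
Lin : Set
Lin = List (C × Word)

-- elements of 𝔥¹_{>0} : finite C-linear combinations of nonempty words
Lin⁺ : Set
Lin⁺ = List (C × Word⁺)

forget : Lin⁺ → Lin
forget = map (λ { (c , (x , w)) → (c , x ∷ w) })

scale : C → Lin → Lin
scale a = map (λ { (c , w) → (a *C c , w) })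

scale⁺ : C → Lin⁺ → Lin⁺
scale⁺ a = map (λ { (c , u) → (a *C c , u) })

pre : Letter → Lin → Lin
pre x = map (λ { (c , w) → (c , x ∷ w) })

pre⁺ : Letter → Lin → Lin⁺
pre⁺ x = map (λ { (c , w) → (c , (x , w)) })

-- z_i ∘₊ z_j = z_{i+j} + ħ z_{i+j-1}, as a C-combination of letters
_∘L_ : Letter → Letter → List (C × Letter)
z₁₊ a ∘L z₁₊ b = (1C , z₁₊ (suc (a +ℕ b))) ∷ (ħ , z₁₊ (a +ℕ b)) ∷ []

preComb : List (C × Letter) → Lin → Lin
preComb ls v = concatMap (λ { (c , l) → map (λ { (c' , w) → (c *C c' , l ∷ w) }) v }) ls

_∘act_ : Letter → Lin → Lin⁺
x ∘act v = concatMap f v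
  where
  f : C × Word → Lin⁺
  f (c , []) = []
  f (c , y ∷ w) = map (λ { (c' , l) → (c *C c' , (l , w)) }) (x ∘L y)

_*w_ : Word → Word → Lin
[] *w w = (1C , w) ∷ []
(x ∷ w₁) *w [] = (1C , x ∷ w₁) ∷ []
(x ∷ w₁) *w (y ∷ w₂) =
  pre x (w₁ *w (y ∷ w₂)) ++ pre y ((x ∷ w₁) *w w₂) ++ preComb (x ∘L y) (w₁ *w w₂)

-- the product ⊛_q on nonempty words: (z_i w₁) ⊛ (z_j w₂) = z_{i+j} (w₁ *₊ w₂)
_⊛w_ : Word⁺ → Word⁺ → Lin⁺
(z₁₊ a , w₁) ⊛w (z₁₊ b , w₂) = pre⁺ (z₁₊ (suc (a +ℕ b))) (w₁ *w w₂)

_⊛_ : Lin⁺ → Lin⁺ → Lin⁺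
v₁ ⊛ v₂ = concatMap (λ { (c₁ , u₁) →
            concatMap (λ { (c₂ , u₂) → scale⁺ (c₁ *C c₂) (u₁ ⊛w u₂) }) v₂ }) v₁

dW : Word → Lin
dW [] = (1C , []) ∷ []
dW (x ∷ w) = pre x (dW w) ++ forget (x ∘act dW w)

dW⁺ : Word⁺ → Lin⁺
dW⁺ (x , w) = pre⁺ x (dW w) ++ (x ∘act dW w)

dq : Lin⁺ → Lin⁺
dq v = concatMap (λ { (c , u) → scale⁺ c (dW⁺ u) }) v

-- R = ℚ[[q]] : formal power series as coefficient sequences

PS : Set
PS = ℕ → ℚ

sumLt : ℕ → (ℕ → ℚ) → ℚ
sumLt zero f = 0ℚ
sumLt (suc n) f = sumLt n f +ℚ f n

_+ₛ_ : PS → PS → PS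
(f +ₛ g) n = f n +ℚ g n

_*ₛ_ : PS → PS → PS
(f *ₛ g) n = sumLt (suc n) (λ i → f i *ℚ g (n ∸ i))

0ₛ : PS
0ₛ n = 0ℚ

constₛ : ℚ → PS
constₛ a zero = a
constₛ a (suc n) = 0ℚ

1ₛ : PS
1ₛ = constₛ 1ℚ

qPow : ℕ → PS
qPow e n = if n ≡ᵇ e then 1ℚ else 0ℚ

_^ₛ_ : PS → ℕ → PS
f ^ₛ zero = 1ₛ
f ^ₛ suc k = f *ₛ (f ^ₛ k)

sumPS1 : ℕ → (ℕ → PS) → PS
sumPS1 zero F = 0ₛ
sumPS1 (suc M) F = sumPS1 M F +ₛ F (suc M)

1-q : PS
1-q zero = 1ℚ
1-q (suc zero) = -ℚ 1ℚ
1-q (suc (suc n)) = 0ℚ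

-- the C-algebra structure map C → R, ħ ↦ 1 - q
evalC : C → PS
evalC [] = 0ₛ
evalC (a ∷ p) = constₛ a +ₛ (1-q *ₛ evalC p)

-- [m] = (1 - q^m)/(1 - q) = 1 + q + ... + q^{m-1}
bracket : ℕ → PS
bracket m n = if n <ᵇ m then 1ℚ else 0ℚ

-- Multiplicative inverse of a power series f with f 0 = 1:
-- b_0 = 1, b_{n} = - Σ_{i=1}^{n} f_i b_{n-i}.
-- invRev f n = [b_n, b_{n-1}, ..., b_0]
dotFrom : PS → ℕ → List ℚ → ℚ
dotFrom f i [] = 0ℚ
dotFrom f i (b ∷ bs) = (f i *ℚ b) +ℚ dotFrom f (suc i) bs

invRev : PS → ℕ → List ℚ
invRev f zero = 1ℚ ∷ []
invRev f (suc n) = (-ℚ dotFrom f 1 (invRev f n)) ∷ invRev f n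

headℚ : List ℚ → ℚ
headℚ [] = 0ℚ
headℚ (b ∷ bs) = b

inv1 : PS → PS
inv1 f n = headℚ (invRev f n)

-- q^e / [m]^k   (m ≥ 1, so [m] has constant term 1)
qfrac : ℕ → ℕ → ℕ → PS
qfrac e m k = qPow e *ₛ (inv1 (bracket m) ^ₛ k)

-- Σ_{m ≥ m_2 ≥ ... ≥ m_r ≥ 1} Π_{j≥2} q^{(k_j - 1) m_j} / [m_j]^{k_j}
sTail : Word → ℕ → PS
sTail [] m = 1ₛ
sTail (z₁₊ a ∷ w) m = sumPS1 m (λ m' → qfrac (a *ℕ m') m' (suc a) *ₛ sTail w m')

-- Σ_{m > m_2 > ... > m_r > 0} Π_{j≥2} q^{(k_j - 1) m_j} / [m_j]^{k_j}
aTail : Word → ℕ → PS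
aTail [] m = 1ₛ
aTail (z₁₊ a ∷ w) m = sumPS1 (m ∸ 1) (λ m' → qfrac (a *ℕ m') m' (suc a) *ₛ aTail w m')

-- s_u(n), u = z_{k_1} w, with m_1 = n + 1 and factor q^{k_1 m_1}/[m_1]^{k_1}
sW : Word⁺ → ℕ → PS
sW (z₁₊ a , w) n = qfrac (suc a *ℕ suc n) (suc n) (suc a) *ₛ sTail w (suc n)

-- a_u(n), with factor q^{(k_1 - 1) m_1}/[m_1]^{k_1}
aW : Word⁺ → ℕ → PS
aW (z₁₊ a , w) n = qfrac (a *ℕ suc n) (suc n) (suc a) *ₛ aTail w (suc n)

s : Lin⁺ → ℕ → PS
s [] n = 0ₛ
s ((c , u) ∷ v) n = (evalC c *ₛ sW u n) +ₛ s v n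

a : Lin⁺ → ℕ → PS
a [] n = 0ₛ
a ((c , u) ∷ v) n = (evalC c *ₛ aW u n) +ₛ a v n

module Submission where

-- Write m = n + 1 and, for a letter z_k, t_k(m) = q^{(k-1)m}/[m]^k (the weight of
-- one summation index).  Then a_{z_k w}(n) = t_k(m) A_w(m) and
-- s_{z_k w}(n) = q^m t_k(m) S_w(m), where A_w(m) (resp. S_w(m)) is the strict
-- (resp. weak) nested sum of w over indices below (resp. up to) m.
--
-- The argument then consists of four facts:
--   (1) the weights realise ∘₊:  t_i t_j = t_{i+j} + (1-q) t_{i+j-1},  t_{i+j} = q^m t_i t_j;
--   (2) strict nested sums multiply by the quasi-shuffle:  A_u A_v = A_{u *₊ v};
--   (3) d_q turns weak sums into strict ones:  S_w(m) = A_{d_q w}(m+1);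
--   (4) consequently  a(V₁ ⊛_q V₂) = q^m a(V₁) a(V₂)  and  s(V) = q^m a(d_q V).
-- (2) and (3) are proved by induction on m, comparing the increments
-- A_L(m+1) - A_L(m) of both sides.  The theorem is the combination of the two
-- identities in (4):  s(w₁) a(w₂) = q^m a(d_q w₁) a(w₂) = a(d_q w₁ ⊛_q w₂).

open import Defs
open import Data.Nat using (ℕ; zero; suc; _∸_) renaming (_+_ to _+ℕ_; _*_ to _*ℕ_)
import Data.Nat.Properties as ℕP
open import Data.Rational using (ℚ; 0ℚ; 1ℚ) renaming (_+_ to _+ℚ_; _*_ to _*ℚ_; -_ to -ℚ_)
import Data.Rational.Properties as ℚP
open import Data.List using (List; []; _∷_; _++_; map; concatMap)
open import Data.Product using (_×_; _,_; proj₁; proj₂; uncurry)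
open import Data.Maybe using (Maybe; just; nothing)
open import Relation.Nullary using (yes; no)
open import Relation.Binary.PropositionalEquality
  using (_≡_; refl; sym; trans; cong; cong₂; module ≡-Reasoning)
open import Algebra using (CommutativeRing; IsCommutativeRing)
open import Tactic.RingSolver using (solve-∀)
open import Tactic.RingSolver.Core.AlmostCommutativeRing using (AlmostCommutativeRing; fromCommutativeRing)
import Algebra.Solver.Ring.AlmostCommutativeRing as ACR
import Algebra.Solver.Ring as RingSolver
import Relation.Binary.Reasoning.Setoid as SetoidReasoning

ℚ-ring : AlmostCommutativeRing _ _
ℚ-ring = fromCommutativeRing ℚP.+-*-commutativeRing isZero
  where
  isZero : ∀ x → Maybe (0ℚ ≡ x)
  isZero x with 0ℚ ℚP.≟ x
  ... | yes p = just p
  ... | no _  = nothing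

record _≈_ (f g : PS) : Set where
  constructor mk≈
  field app : ∀ n → f n ≡ g n
open _≈_
infix 4 _≈_

≈-refl : ∀ {f} → f ≈ f
≈-refl = mk≈ λ n → refl

≈-sym : ∀ {f g} → f ≈ g → g ≈ f
≈-sym p = mk≈ λ n → sym (app p n)

≈-trans : ∀ {f g h} → f ≈ g → g ≈ h → f ≈ h
≈-trans p q = mk≈ λ n → trans (app p n) (app q n)

≡⇒≈ : ∀ {f g} → f ≡ g → f ≈ g
≡⇒≈ refl = ≈-refl

shift : PS → PS
shift f i = f (suc i)

-- The Cauchy product in recursive form:
-- (f g)_{n+1} = f₀ g_{n+1} + ((shift f) g)_n.  Its laws follow by induction on n.
conv : PS → PS → PS
conv f g zero = f 0 *ℚ g 0
conv f g (suc n) = f 0 *ℚ g (suc n) +ℚ conv (shift f) g n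

sumLt-peel : ∀ n h → sumLt (suc n) h ≡ h 0 +ℚ sumLt n (λ i → h (suc i))
sumLt-peel zero h = trans (ℚP.+-identityˡ (h 0)) (sym (ℚP.+-identityʳ (h 0)))
sumLt-peel (suc n) h = trans (cong (_+ℚ h (suc n)) (sumLt-peel n h)) (ℚP.+-assoc (h 0) _ _)

*ₛ-conv : ∀ f g n → (f *ₛ g) n ≡ conv f g n
*ₛ-conv f g zero = ℚP.+-identityˡ _
*ₛ-conv f g (suc n) = trans (sumLt-peel (suc n) (λ i → f i *ℚ g (suc n ∸ i)))
  (cong (f 0 *ℚ g (suc n) +ℚ_) (*ₛ-conv (shift f) g n))

conv-cong : ∀ {f f' g g'} → (∀ n → f n ≡ f' n) → (∀ n → g n ≡ g' n) →
  ∀ n → conv f g n ≡ conv f' g' n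
conv-cong p q zero = cong₂ _*ℚ_ (p 0) (q 0)
conv-cong p q (suc n) = cong₂ _+ℚ_ (cong₂ _*ℚ_ (p 0) (q (suc n))) (conv-cong (λ i → p (suc i)) q n)

conv-zeroˡ : ∀ g n → conv 0ₛ g n ≡ 0ℚ
conv-zeroˡ g zero = ℚP.*-zeroˡ (g 0)
conv-zeroˡ g (suc n) = trans (cong₂ _+ℚ_ (ℚP.*-zeroˡ (g (suc n))) (conv-zeroˡ g n)) (ℚP.+-identityˡ 0ℚ)

conv-constˡ : ∀ c g n → conv (constₛ c) g n ≡ c *ℚ g n
conv-constˡ c g zero = refl
conv-constˡ c g (suc n) = trans (cong (c *ℚ g (suc n) +ℚ_) (conv-zeroˡ g n)) (ℚP.+-identityʳ _)

conv-identityˡ : ∀ g n → conv 1ₛ g n ≡ g n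
conv-identityˡ g n = trans (conv-constˡ 1ℚ g n) (ℚP.*-identityˡ (g n))

conv-distribʳ : ∀ f g h n → conv (f +ₛ g) h n ≡ conv f h n +ℚ conv g h n
conv-distribʳ f g h zero = ℚP.*-distribʳ-+ (h 0) (f 0) (g 0)
conv-distribʳ f g h (suc n) =
  trans (cong₂ _+ℚ_ (ℚP.*-distribʳ-+ (h (suc n)) (f 0) (g 0)) (conv-distribʳ (shift f) (shift g) h n))
        (interchange (f 0 *ℚ h (suc n)) (g 0 *ℚ h (suc n)) (conv (shift f) h n) (conv (shift g) h n))
  where
  interchange : ∀ a b c d → (a +ℚ b) +ℚ (c +ℚ d) ≡ (a +ℚ c) +ℚ (b +ℚ d)
  interchange = solve-∀ ℚ-ring

conv-distribˡ : ∀ f g h n → conv f (g +ₛ h) n ≡ conv f g n +ℚ conv f h n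
conv-distribˡ f g h zero = ℚP.*-distribˡ-+ (f 0) (g 0) (h 0)
conv-distribˡ f g h (suc n) =
  trans (cong₂ _+ℚ_ (ℚP.*-distribˡ-+ (f 0) (g (suc n)) (h (suc n))) (conv-distribˡ (shift f) g h n))
        (interchange (f 0 *ℚ g (suc n)) (f 0 *ℚ h (suc n)) (conv (shift f) g n) (conv (shift f) h n))
  where
  interchange : ∀ a b c d → (a +ℚ b) +ℚ (c +ℚ d) ≡ (a +ℚ c) +ℚ (b +ℚ d)
  interchange = solve-∀ ℚ-ring

conv-scaleˡ : ∀ c f g n → conv (λ i → c *ℚ f i) g n ≡ c *ℚ conv f g n
conv-scaleˡ c f g zero = ℚP.*-assoc c (f 0) (g 0)
conv-scaleˡ c f g (suc n) =
  trans (cong₂ _+ℚ_ (ℚP.*-assoc c (f 0) (g (suc n))) (conv-scaleˡ c (shift f) g n))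
        (sym (ℚP.*-distribˡ-+ c _ _))

conv-comm : ∀ f g n → conv f g n ≡ conv g f n
conv-comm f g zero = ℚP.*-comm (f 0) (g 0)
conv-comm f g (suc zero) = swap (f 0) (g 1) (f 1) (g 0)
  where
  swap : ∀ a b c d → a *ℚ b +ℚ c *ℚ d ≡ d *ℚ c +ℚ b *ℚ a
  swap = solve-∀ ℚ-ring
conv-comm f g (suc (suc n)) = begin
  f 0 *ℚ g (2+ n) +ℚ conv (shift f) g (suc n)
    ≡⟨ cong (f 0 *ℚ g (2+ n) +ℚ_) (conv-comm (shift f) g (suc n)) ⟩
  f 0 *ℚ g (2+ n) +ℚ (g 0 *ℚ f (2+ n) +ℚ conv (shift g) (shift f) n)
    ≡⟨ cong (λ x → f 0 *ℚ g (2+ n) +ℚ (g 0 *ℚ f (2+ n) +ℚ x)) (conv-comm (shift g) (shift f) n) ⟩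
  f 0 *ℚ g (2+ n) +ℚ (g 0 *ℚ f (2+ n) +ℚ conv (shift f) (shift g) n)
    ≡⟨ swap (f 0) (g (2+ n)) (g 0) (f (2+ n)) (conv (shift f) (shift g) n) ⟩
  g 0 *ℚ f (2+ n) +ℚ (f 0 *ℚ g (2+ n) +ℚ conv (shift f) (shift g) n)
    ≡⟨ cong (g 0 *ℚ f (2+ n) +ℚ_) (sym (conv-comm (shift g) f (suc n))) ⟩
  g 0 *ℚ f (2+ n) +ℚ conv (shift g) f (suc n) ∎
  where
  open ≡-Reasoning
  2+ : ℕ → ℕ
  2+ k = suc (suc k)
  swap : ∀ a b c d e → a *ℚ b +ℚ (c *ℚ d +ℚ e) ≡ c *ℚ d +ℚ (a *ℚ b +ℚ e)
  swap = solve-∀ ℚ-ring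

conv-assoc : ∀ f g h n → conv (conv f g) h n ≡ conv f (conv g h) n
conv-assoc f g h zero = ℚP.*-assoc (f 0) (g 0) (h 0)
conv-assoc f g h (suc n) = begin
  (f 0 *ℚ g 0) *ℚ h (suc n) +ℚ conv (shift (conv f g)) h n
    ≡⟨ cong ((f 0 *ℚ g 0) *ℚ h (suc n) +ℚ_)
            (conv-distribʳ (λ i → f 0 *ℚ g (suc i)) (conv (shift f) g) h n) ⟩
  (f 0 *ℚ g 0) *ℚ h (suc n) +ℚ (conv (λ i → f 0 *ℚ g (suc i)) h n +ℚ conv (conv (shift f) g) h n)
    ≡⟨ cong₂ (λ x y → (f 0 *ℚ g 0) *ℚ h (suc n) +ℚ (x +ℚ y))
             (conv-scaleˡ (f 0) (shift g) h n) (conv-assoc (shift f) g h n) ⟩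
  (f 0 *ℚ g 0) *ℚ h (suc n) +ℚ (f 0 *ℚ conv (shift g) h n +ℚ conv (shift f) (conv g h) n)
    ≡⟨ regroup (f 0) (g 0) (h (suc n)) (conv (shift g) h n) (conv (shift f) (conv g h) n) ⟩
  f 0 *ℚ (g 0 *ℚ h (suc n) +ℚ conv (shift g) h n) +ℚ conv (shift f) (conv g h) n ∎
  where
  open ≡-Reasoning
  regroup : ∀ a b c d e → (a *ℚ b) *ℚ c +ℚ (a *ℚ d +ℚ e) ≡ a *ℚ (b *ℚ c +ℚ d) +ℚ e
  regroup = solve-∀ ℚ-ring

-ₛ_ : PS → PS
(-ₛ f) n = -ℚ f n

via-conv : ∀ {f g f' g'} → (∀ n → conv f g n ≡ conv f' g' n) → f *ₛ g ≈ f' *ₛ g'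
via-conv {f} {g} {f'} {g'} p = mk≈ λ n → trans (*ₛ-conv f g n) (trans (p n) (sym (*ₛ-conv f' g' n)))

PS-isCommutativeRing : IsCommutativeRing _≈_ _+ₛ_ _*ₛ_ -ₛ_ 0ₛ 1ₛ
PS-isCommutativeRing = record
  { isRing = record
    { +-isAbelianGroup = record
      { isGroup = record
        { isMonoid = record
          { isSemigroup = record
            { isMagma = record
              { isEquivalence = record { refl = ≈-refl ; sym = ≈-sym ; trans = ≈-trans }
              ; ∙-cong = λ p q → mk≈ λ n → cong₂ _+ℚ_ (app p n) (app q n) }
            ; assoc = λ f g h → mk≈ λ n → ℚP.+-assoc (f n) (g n) (h n) }
          ; identity = (λ f → mk≈ λ n → ℚP.+-identityˡ (f n))
                     , (λ f → mk≈ λ n → ℚP.+-identityʳ (f n)) }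
        ; inverse = (λ f → mk≈ λ n → ℚP.+-inverseˡ (f n)) , (λ f → mk≈ λ n → ℚP.+-inverseʳ (f n))
        ; ⁻¹-cong = λ p → mk≈ λ n → cong -ℚ_ (app p n) }
      ; comm = λ f g → mk≈ λ n → ℚP.+-comm (f n) (g n) }
    ; *-cong = λ p q → via-conv (conv-cong (app p) (app q))
    ; *-assoc = λ f g h → mk≈ λ n → begin
        ((f *ₛ g) *ₛ h) n       ≡⟨ *ₛ-conv (f *ₛ g) h n ⟩
        conv (f *ₛ g) h n       ≡⟨ conv-cong (*ₛ-conv f g) (λ _ → refl) n ⟩
        conv (conv f g) h n     ≡⟨ conv-assoc f g h n ⟩
        conv f (conv g h) n     ≡⟨ conv-cong (λ _ → refl) (λ i → sym (*ₛ-conv g h i)) n ⟩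
        conv f (g *ₛ h) n       ≡⟨ sym (*ₛ-conv f (g *ₛ h) n) ⟩
        (f *ₛ (g *ₛ h)) n       ∎
    ; *-identity = (λ f → mk≈ λ n → trans (*ₛ-conv 1ₛ f n) (conv-identityˡ f n))
                 , (λ f → mk≈ λ n → trans (*ₛ-conv f 1ₛ n) (trans (conv-comm f 1ₛ n) (conv-identityˡ f n)))
    ; distrib = (λ f g h → mk≈ λ n → trans (*ₛ-conv f (g +ₛ h) n) (trans (conv-distribˡ f g h n)
                                        (sym (cong₂ _+ℚ_ (*ₛ-conv f g n) (*ₛ-conv f h n)))))
              , (λ h f g → mk≈ λ n → trans (*ₛ-conv (f +ₛ g) h n) (trans (conv-distribʳ f g h n)
                                        (sym (cong₂ _+ℚ_ (*ₛ-conv f h n) (*ₛ-conv g h n)))))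
    }
  ; *-comm = λ f g → via-conv (conv-comm f g)
  }
  where open ≡-Reasoning

PS-ring : CommutativeRing _ _
PS-ring = record { isCommutativeRing = PS-isCommutativeRing }

open CommutativeRing PS-ring
  using (_+_; _*_; +-cong; *-cong; +-assoc; zeroˡ; zeroʳ; +-identityˡ; +-identityʳ;
         *-identityˡ; *-identityʳ; *-comm; *-assoc; distribˡ; setoid)
  renaming (0# to 𝟘; 1# to 𝟙)
module ≈-Reasoning = SetoidReasoning setoid

+-congˡ : ∀ x {y z} → y ≈ z → x + y ≈ x + z
+-congˡ x p = +-cong (≈-refl {x}) p

+-congʳ : ∀ x {y z} → y ≈ z → y + x ≈ z + x
+-congʳ x p = +-cong p (≈-refl {x})

*-congˡ : ∀ x {y z} → y ≈ z → x * y ≈ x * z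
*-congˡ x p = *-cong (≈-refl {x}) p

*-congʳ : ∀ x {y z} → y ≈ z → y * x ≈ z * x
*-congʳ x p = *-cong p (≈-refl {x})

-- Constant series embed ℚ into R; through this embedding the ring solver for R
-- works with rational coefficients, which compute.

constₛ-+ : ∀ a b → constₛ (a +ℚ b) ≈ constₛ a + constₛ b
constₛ-+ a b = mk≈ λ { zero → refl ; (suc n) → sym (ℚP.+-identityˡ 0ℚ) }

constₛ-* : ∀ a b → constₛ (a *ℚ b) ≈ constₛ a * constₛ b
constₛ-* a b = mk≈ λ
  { zero → sym (trans (*ₛ-conv (constₛ a) (constₛ b) 0) (conv-constˡ a (constₛ b) 0))
  ; (suc n) → sym (trans (*ₛ-conv (constₛ a) (constₛ b) (suc n))
                  (trans (conv-constˡ a (constₛ b) (suc n)) (ℚP.*-zeroʳ a))) }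

constₛ-0 : constₛ 0ℚ ≈ 𝟘
constₛ-0 = mk≈ λ { zero → refl ; (suc n) → refl }

PS-almostRing : ACR.AlmostCommutativeRing _ _
PS-almostRing = ACR.fromCommutativeRing PS-ring

constₛ-hom : CommutativeRing.rawRing ℚP.+-*-commutativeRing ACR.-Raw-AlmostCommutative⟶ PS-almostRing
constₛ-hom = record
  { ⟦_⟧ = constₛ
  ; +-homo = constₛ-+
  ; *-homo = constₛ-*
  ; -‿homo = λ a → mk≈ λ { zero → refl ; (suc n) → refl }
  ; 0-homo = constₛ-0
  ; 1-homo = ≈-refl
  }

constₛ-≟ : ∀ a b → Maybe (constₛ a ≈ constₛ b)
constₛ-≟ a b with a ℚP.≟ b
... | yes refl = just ≈-refl
... | no _     = nothing

module S = RingSolver (CommutativeRing.rawRing ℚP.+-*-commutativeRing) PS-almostRing constₛ-hom constₛ-≟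
open S using (_:+_; _:*_; _:=_)

evalC-+ : ∀ p q → evalC (p +C q) ≈ evalC p + evalC q
evalC-+ [] q = ≈-sym (+-identityˡ (evalC q))
evalC-+ (x ∷ p) [] = ≈-sym (+-identityʳ _)
evalC-+ (x ∷ p) (y ∷ q) =
  ≈-trans (+-cong (constₛ-+ x y) (≈-trans (*-congˡ 1-q (evalC-+ p q)) (distribˡ 1-q (evalC p) (evalC q))))
          (S.solve 4 (λ A B C D → ((A :+ B) :+ (C :+ D)) := ((A :+ C) :+ (B :+ D))) ≈-refl
                   (constₛ x) (constₛ y) (1-q * evalC p) (1-q * evalC q))

evalC-scale : ∀ a q → evalC (map (a *ℚ_) q) ≈ constₛ a * evalC q
evalC-scale a [] = ≈-sym (zeroʳ (constₛ a))
evalC-scale a (b ∷ q) =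
  ≈-trans (+-cong (constₛ-* a b) (*-congˡ 1-q (evalC-scale a q)))
          (S.solve 4 (λ A B X E → (A :* B :+ X :* (A :* E)) := (A :* (B :+ X :* E))) ≈-refl
                   (constₛ a) (constₛ b) 1-q (evalC q))

evalC-* : ∀ p q → evalC (p *C q) ≈ evalC p * evalC q
evalC-* [] q = ≈-sym (zeroˡ (evalC q))
evalC-* (a ∷ p) q = begin
  evalC (map (a *ℚ_) q +C (0ℚ ∷ (p *C q)))
    ≈⟨ evalC-+ (map (a *ℚ_) q) (0ℚ ∷ (p *C q)) ⟩
  evalC (map (a *ℚ_) q) + (constₛ 0ℚ + 1-q * evalC (p *C q))
    ≈⟨ +-cong (evalC-scale a q) (+-congˡ (constₛ 0ℚ) (*-congˡ 1-q (evalC-* p q))) ⟩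
  constₛ a * evalC q + (constₛ 0ℚ + 1-q * (evalC p * evalC q))
    ≈⟨ S.solve 4 (λ A Q X P → (A :* Q :+ (S.con 0ℚ :+ X :* (P :* Q))) := ((A :+ X :* P) :* Q)) ≈-refl
               (constₛ a) (evalC q) 1-q (evalC p) ⟩
  (constₛ a + 1-q * evalC p) * evalC q ∎
  where open ≈-Reasoning

evalC-1 : evalC 1C ≈ 𝟙
evalC-1 = ≈-trans (+-congˡ 𝟙 (zeroʳ 1-q)) (+-identityʳ 𝟙)

evalC-ħ : evalC ħ ≈ 1-q
evalC-ħ = ≈-trans (+-cong constₛ-0 (*-congˡ 1-q evalC-1))
                  (≈-trans (+-identityˡ (1-q * 𝟙)) (*-identityʳ 1-q))

qPow-zero : qPow 0 ≈ 𝟙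
qPow-zero = mk≈ λ { zero → refl ; (suc n) → refl }

qPow-+ : ∀ a b → qPow a * qPow b ≈ qPow (a +ℕ b)
qPow-+ zero b = ≈-trans (*-congʳ (qPow b) qPow-zero) (*-identityˡ (qPow b))
qPow-+ (suc a) b = mk≈ λ
  { zero → trans (*ₛ-conv (qPow (suc a)) (qPow b) zero) (ℚP.*-zeroˡ (qPow b 0))
  ; (suc n) → begin
      (qPow (suc a) * qPow b) (suc n)       ≡⟨ *ₛ-conv (qPow (suc a)) (qPow b) (suc n) ⟩
      0ℚ *ℚ qPow b (suc n) +ℚ conv (qPow a) (qPow b) n
        ≡⟨ trans (cong (_+ℚ conv (qPow a) (qPow b) n) (ℚP.*-zeroˡ (qPow b (suc n)))) (ℚP.+-identityˡ _) ⟩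
      conv (qPow a) (qPow b) n              ≡⟨ sym (*ₛ-conv (qPow a) (qPow b) n) ⟩
      (qPow a * qPow b) n                   ≡⟨ app (qPow-+ a b) n ⟩
      qPow (a +ℕ b) n                       ∎ }
  where open ≡-Reasoning

1-q-difference : ∀ f n → conv 1-q f (suc n) ≡ f (suc n) +ℚ -ℚ f n
1-q-difference f zero = normalise (f 1) (f 0)
  where
  normalise : ∀ x y → 1ℚ *ℚ x +ℚ -ℚ 1ℚ *ℚ y ≡ x +ℚ -ℚ y
  normalise = solve-∀ ℚ-ring
1-q-difference f (suc n) =
  trans (cong (λ z → 1ℚ *ℚ f (suc (suc n)) +ℚ (-ℚ 1ℚ *ℚ f (suc n) +ℚ z)) (conv-zeroˡ f n))
        (normalise (f (suc (suc n))) (f (suc n)))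
  where
  normalise : ∀ x y → 1ℚ *ℚ x +ℚ (-ℚ 1ℚ *ℚ y +ℚ 0ℚ) ≡ x +ℚ -ℚ y
  normalise = solve-∀ ℚ-ring

bracket-identity : ∀ m → qPow m + 1-q * bracket m ≈ 𝟙
bracket-identity m = mk≈ λ
  { zero → trans (cong (qPow m 0 +ℚ_) (trans (*ₛ-conv 1-q (bracket m) 0) (ℚP.*-identityˡ _))) (constant m)
  ; (suc n) → trans (cong (qPow m (suc n) +ℚ_) (trans (*ₛ-conv 1-q (bracket m) (suc n))
                                                      (1-q-difference (bracket m) n)))
                    (higher m n) }
  where
  constant : ∀ m → qPow m 0 +ℚ bracket m 0 ≡ 1ℚ
  constant zero = refl
  constant (suc m) = refl
  higher : ∀ m n → qPow m (suc n) +ℚ (bracket m (suc n) +ℚ -ℚ bracket m n) ≡ 0ℚ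
  higher zero n = refl
  higher (suc zero) zero = refl
  higher (suc (suc m)) zero = refl
  higher (suc m) (suc n) = higher m n

-- The recursion defining inv1 is the convolution equation (f · inv1 f)_{n+1} = 0.
dotFrom-conv : ∀ f j n → dotFrom f j (invRev f n) ≡ conv (λ i → f (j +ℕ i)) (inv1 f) n
dotFrom-conv f j zero = trans (trans (ℚP.+-identityʳ _) (ℚP.*-identityʳ (f j)))
  (sym (trans (ℚP.*-identityʳ _) (cong f (ℕP.+-identityʳ j))))
dotFrom-conv f j (suc n) = cong₂ _+ℚ_ (cong (λ k → f k *ℚ inv1 f (suc n)) (sym (ℕP.+-identityʳ j)))
  (trans (dotFrom-conv f (suc j) n) (conv-cong (λ i → cong f (sym (ℕP.+-suc j i))) (λ _ → refl) n))

inv1-inverse : ∀ f → f 0 ≡ 1ℚ → f * inv1 f ≈ 𝟙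
inv1-inverse f f₀≡1 = mk≈ λ
  { zero → trans (*ₛ-conv f (inv1 f) 0) (cong (_*ℚ 1ℚ) f₀≡1)
  ; (suc n) → trans (*ₛ-conv f (inv1 f) (suc n))
      (trans (cong₂ (λ a b → a *ℚ -ℚ b +ℚ conv (shift f) (inv1 f) n) f₀≡1 (dotFrom-conv f 1 n))
             (cancel (conv (shift f) (inv1 f) n))) }
  where
  cancel : ∀ x → 1ℚ *ℚ -ℚ x +ℚ x ≡ 0ℚ
  cancel = solve-∀ ℚ-ring

^ₛ-+ : ∀ f k l → f ^ₛ (k +ℕ l) ≈ (f ^ₛ k) * (f ^ₛ l)
^ₛ-+ f zero l = ≈-sym (*-identityˡ (f ^ₛ l))
^ₛ-+ f (suc k) l = ≈-trans (*-congˡ f (^ₛ-+ f k l)) (≈-sym (*-assoc f (f ^ₛ k) (f ^ₛ l)))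

-- (1) t_k(m) = q^{(k-1)m}/[m]^k, the factor contributed by an index m carrying z_k.
weight : Letter → ℕ → PS
weight (z₁₊ a) m = qfrac (a *ℕ m) m (suc a)

-- 1/[m] = q^m/[m] + (1 - q)  for m ≥ 1 (divide q^m + (1 - q)[m] = 1 by [m]).
inverse-bracket : ∀ K → inv1 (bracket (suc K)) ≈ qPow (suc K) * inv1 (bracket (suc K)) + 1-q
inverse-bracket K = begin
  I                   ≈⟨ ≈-sym (*-identityʳ I) ⟩
  I * 𝟙               ≈⟨ *-congˡ I (≈-sym (bracket-identity m)) ⟩
  I * (Q + 1-q * B)
    ≈⟨ S.solve 4 (λ I Q X B → (I :* (Q :+ X :* B)) := (Q :* I :+ X :* (B :* I))) ≈-refl I Q 1-q B ⟩
  Q * I + 1-q * (B * I) ≈⟨ +-congˡ (Q * I) (≈-trans (*-congˡ 1-q (inv1-inverse B refl)) (*-identityʳ 1-q)) ⟩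
  Q * I + 1-q ∎
  where
  open ≈-Reasoning
  m = suc K
  Q = qPow m
  B = bracket m
  I = inv1 B

weight-product : ∀ a b m →
  weight (z₁₊ a) m * weight (z₁₊ b) m
    ≈ qPow ((a +ℕ b) *ℕ m) * (inv1 (bracket m) * inv1 (bracket m) ^ₛ suc (a +ℕ b))
weight-product a b m = begin
  (qPow (a *ℕ m) * I ^ₛ suc a) * (qPow (b *ℕ m) * I ^ₛ suc b)
    ≈⟨ S.solve 4 (λ A IA B IB → ((A :* IA) :* (B :* IB)) := ((A :* B) :* (IA :* IB))) ≈-refl
               (qPow (a *ℕ m)) (I ^ₛ suc a) (qPow (b *ℕ m)) (I ^ₛ suc b) ⟩
  (qPow (a *ℕ m) * qPow (b *ℕ m)) * (I ^ₛ suc a * I ^ₛ suc b)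
    ≈⟨ *-cong (≈-trans (qPow-+ (a *ℕ m) (b *ℕ m)) (≡⇒≈ (cong qPow (sym (ℕP.*-distribʳ-+ m a b)))))
              (≈-trans (≈-sym (^ₛ-+ I (suc a) (suc b)))
                       (≡⇒≈ (cong (λ k → I ^ₛ suc k) (ℕP.+-suc a b)))) ⟩
  qPow ((a +ℕ b) *ℕ m) * (I * I ^ₛ suc (a +ℕ b)) ∎
  where
  open ≈-Reasoning
  I = inv1 (bracket m)

-- The weights realise z_i ∘₊ z_j = z_{i+j} + ħ z_{i+j-1}:
-- t_i t_j = t_{i+j} + (1 - q) t_{i+j-1}.
weight-∘ : ∀ a b K →
  weight (z₁₊ a) (suc K) * weight (z₁₊ b) (suc K)
    ≈ weight (z₁₊ (suc (a +ℕ b))) (suc K) + 1-q * weight (z₁₊ (a +ℕ b)) (suc K)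
weight-∘ a b K = begin
  weight (z₁₊ a) m * weight (z₁₊ b) m ≈⟨ weight-product a b m ⟩
  P * (I * J)                         ≈⟨ *-congˡ P (*-congʳ J (inverse-bracket K)) ⟩
  P * ((Q * I + 1-q) * J)
    ≈⟨ S.solve 5 (λ P Q I X J → (P :* ((Q :* I :+ X) :* J)) := ((Q :* P) :* (I :* J) :+ X :* (P :* J)))
                 ≈-refl P Q I 1-q J ⟩
  (Q * P) * (I * J) + 1-q * (P * J)   ≈⟨ +-congʳ (1-q * (P * J)) (*-congʳ (I * J) (qPow-+ m ((a +ℕ b) *ℕ m))) ⟩
  weight (z₁₊ (suc (a +ℕ b))) m + 1-q * weight (z₁₊ (a +ℕ b)) m ∎
  where
  open ≈-Reasoning
  m = suc K
  Q = qPow m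
  P = qPow ((a +ℕ b) *ℕ m)
  I = inv1 (bracket m)
  J = I ^ₛ suc (a +ℕ b)

-- The leading letter of z_i ⊛_q z_j:  t_{i+j} = q^m t_i t_j.
weight-⊛ : ∀ a b m → weight (z₁₊ (suc (a +ℕ b))) m ≈ qPow m * (weight (z₁₊ a) m * weight (z₁₊ b) m)
weight-⊛ a b m = begin
  qPow (m +ℕ (a +ℕ b) *ℕ m) * (I * J)   ≈⟨ *-congʳ (I * J) (≈-sym (qPow-+ m ((a +ℕ b) *ℕ m))) ⟩
  (qPow m * P) * (I * J)               ≈⟨ *-assoc (qPow m) P (I * J) ⟩
  qPow m * (P * (I * J))               ≈⟨ *-congˡ (qPow m) (≈-sym (weight-product a b m)) ⟩
  qPow m * (weight (z₁₊ a) m * weight (z₁₊ b) m) ∎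
  where
  open ≈-Reasoning
  P = qPow ((a +ℕ b) *ℕ m)
  I = inv1 (bracket m)
  J = I ^ₛ suc (a +ℕ b)

s-leading : ∀ a m → qfrac (suc a *ℕ m) m (suc a) ≈ qPow m * weight (z₁₊ a) m
s-leading a m = ≈-trans (*-congʳ (inv1 (bracket m) ^ₛ suc a) (≈-sym (qPow-+ m (a *ℕ m))))
                        (*-assoc (qPow m) (qPow (a *ℕ m)) (inv1 (bracket m) ^ₛ suc a))

lsum : {X : Set} → (X → PS) → List X → PS
lsum f [] = 𝟘
lsum f (x ∷ xs) = f x + lsum f xs

lsum-++ : {X : Set} (f : X → PS) (L M : List X) → lsum f (L ++ M) ≈ lsum f L + lsum f M
lsum-++ f [] M = ≈-sym (+-identityˡ (lsum f M))
lsum-++ f (x ∷ L) M = ≈-trans (+-congˡ (f x) (lsum-++ f L M)) (≈-sym (+-assoc (f x) (lsum f L) (lsum f M)))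

lsum-cong : {X : Set} {f g : X → PS} (L : List X) → (∀ x → f x ≈ g x) → lsum f L ≈ lsum g L
lsum-cong [] p = ≈-refl
lsum-cong (x ∷ L) p = +-cong (p x) (lsum-cong L p)

lsum-map : {X Y : Set} (f : Y → PS) (g : X → Y) (L : List X) → lsum f (map g L) ≈ lsum (λ x → f (g x)) L
lsum-map f g [] = ≈-refl
lsum-map f g (x ∷ L) = +-congˡ (f (g x)) (lsum-map f g L)

lsum-concatMap : {X Y : Set} (f : Y → PS) (g : X → List Y) (L : List X) →
  lsum f (concatMap g L) ≈ lsum (λ x → lsum f (g x)) L
lsum-concatMap f g [] = ≈-refl
lsum-concatMap f g (x ∷ L) = ≈-trans (lsum-++ f (g x) (concatMap g L)) (+-congˡ (lsum f (g x)) (lsum-concatMap f g L))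

weigh : {X : Set} → (X → PS) → C × X → PS
weigh f (c , x) = evalC c * f x

linExt : {X : Set} → (X → PS) → List (C × X) → PS
linExt f = lsum (weigh f)

linExt-cong : {X : Set} {f g : X → PS} (V : List (C × X)) → (∀ x → f x ≈ g x) → linExt f V ≈ linExt g V
linExt-cong V p = lsum-cong V λ { (c , x) → *-congˡ (evalC c) (p x) }

linExt-zero : {X : Set} {f : X → PS} (V : List (C × X)) → (∀ x → f x ≈ 𝟘) → linExt f V ≈ 𝟘
linExt-zero [] p = ≈-refl
linExt-zero ((c , x) ∷ V) p =
  ≈-trans (+-cong (≈-trans (*-congˡ (evalC c) (p x)) (zeroʳ (evalC c))) (linExt-zero V p)) (+-identityˡ 𝟘)

linExt-unit : {X : Set} (f : X → PS) (x : X) → linExt f ((1C , x) ∷ []) ≈ f x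
linExt-unit f x = ≈-trans (+-identityʳ _) (≈-trans (*-congʳ (f x) evalC-1) (*-identityˡ (f x)))

linExt-*ˡ : {X : Set} (k : PS) (f : X → PS) (V : List (C × X)) → k * linExt f V ≈ linExt (λ x → k * f x) V
linExt-*ˡ k f [] = zeroʳ k
linExt-*ˡ k f ((c , x) ∷ V) = ≈-trans (distribˡ k (evalC c * f x) (linExt f V))
  (+-cong (S.solve 3 (λ K E F → (K :* (E :* F)) := (E :* (K :* F))) ≈-refl k (evalC c) (f x)) (linExt-*ˡ k f V))

rescale : ∀ c c' y → evalC (c *C c') * y ≈ evalC c' * (evalC c * y)
rescale c c' y = ≈-trans (*-congʳ y (evalC-* c c'))
  (S.solve 3 (λ E E' Y → (E :* E' :* Y) := (E' :* (E :* Y))) ≈-refl (evalC c) (evalC c') y)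

linExt-rescale : {X Y : Set} (f : Y → PS) (c : C) (h : X → Y) (g : C × X → C × Y) →
  (∀ c' x → g (c' , x) ≡ (c *C c' , h x)) →
  (L : List (C × X)) → linExt f (map g L) ≈ evalC c * linExt (λ x → f (h x)) L
linExt-rescale f c h g g-def L = begin
  linExt f (map g L)                            ≈⟨ lsum-map (weigh f) g L ⟩
  lsum (λ p → weigh f (g p)) L
    ≈⟨ lsum-cong L (λ { (c' , x) → ≈-trans (≡⇒≈ (cong (weigh f) (g-def c' x))) (rescale c c' (f (h x))) }) ⟩
  linExt (λ x → evalC c * f (h x)) L            ≈⟨ ≈-sym (linExt-*ˡ (evalC c) (λ x → f (h x)) L) ⟩
  evalC c * linExt (λ x → f (h x)) L            ∎
  where open ≈-Reasoning

linExt-scale⁺ : (f : Word⁺ → PS) (c : C) (V : Lin⁺) → linExt f (scale⁺ c V) ≈ evalC c * linExt f V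
linExt-scale⁺ f c V = linExt-rescale f c (λ u → u) _ (λ _ _ → refl) V

linExt-pre : (f : Word → PS) (x : Letter) (L : Lin) → linExt f (pre x L) ≈ linExt (λ w → f (x ∷ w)) L
linExt-pre f x [] = ≈-refl
linExt-pre f x ((c , w) ∷ L) = +-congˡ (evalC c * f (x ∷ w)) (linExt-pre f x L)

linExt-pre⁺ : (f : Word⁺ → PS) (x : Letter) (L : Lin) → linExt f (pre⁺ x L) ≈ linExt (λ w → f (x , w)) L
linExt-pre⁺ f x [] = ≈-refl
linExt-pre⁺ f x ((c , w) ∷ L) = +-congˡ (evalC c * f (x , w)) (linExt-pre⁺ f x L)

linExt-forget : (f : Word → PS) (V : Lin⁺) → linExt f (forget V) ≈ linExt (λ u → f (uncurry _∷_ u)) V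
linExt-forget f [] = ≈-refl
linExt-forget f ((c , (x , w)) ∷ V) = +-congˡ (evalC c * f (x ∷ w)) (linExt-forget f V)

linExt-preComb : (f : Word → PS) (ls : List (C × Letter)) (L : Lin) →
  linExt f (preComb ls L) ≈ linExt (λ l → linExt (λ w → f (l ∷ w)) L) ls
linExt-preComb f ls L = ≈-trans (lsum-concatMap (weigh f) _ ls)
  (lsum-cong ls λ { (c , l) → linExt-rescale f c (l ∷_) _ (λ _ _ → refl) L })

onAct : (Word⁺ → PS) → Letter → Word → PS
onAct f x [] = 𝟘
onAct f x (y ∷ w) = linExt (λ l → f (l , w)) (x ∘L y)

linExt-∘act : (f : Word⁺ → PS) (x : Letter) (L : Lin) → linExt f (x ∘act L) ≈ linExt (onAct f x) L
linExt-∘act f x L = ≈-trans (lsum-concatMap (weigh f) _ L) (lsum-cong L λ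
  { (c , []) → ≈-sym (zeroʳ (evalC c))
  ; (c , y ∷ w) → linExt-rescale f c (λ l → (l , w)) _ (λ _ _ → refl) (x ∘L y) })

linExt-dq : (f : Word⁺ → PS) (V : Lin⁺) → linExt f (dq V) ≈ linExt (λ u → linExt f (dW⁺ u)) V
linExt-dq f [] = ≈-refl
linExt-dq f ((c , u) ∷ V) = ≈-trans (lsum-++ (weigh f) (scale⁺ c (dW⁺ u)) (dq V))
  (+-cong (linExt-scale⁺ f c (dW⁺ u)) (linExt-dq f V))

linExt-⊛ : (f : Word⁺ → PS) (V₁ V₂ : Lin⁺) →
  linExt f (V₁ ⊛ V₂) ≈ linExt (λ u₁ → linExt (λ u₂ → linExt f (u₁ ⊛w u₂)) V₂) V₁
linExt-⊛ f [] V₂ = ≈-refl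
linExt-⊛ f ((c₁ , u₁) ∷ V₁) V₂ = ≈-trans (lsum-++ (weigh f) (concatMap _ V₂) (V₁ ⊛ V₂))
  (+-cong row (linExt-⊛ f V₁ V₂))
  where
  F : Word⁺ → PS
  F u₂ = linExt f (u₁ ⊛w u₂)
  row : lsum (weigh f) (concatMap _ V₂) ≈ evalC c₁ * linExt F V₂
  row = begin
    lsum (weigh f) (concatMap _ V₂)
      ≈⟨ lsum-concatMap (weigh f) _ V₂ ⟩
    lsum (λ p → linExt f (scale⁺ (c₁ *C proj₁ p) (u₁ ⊛w proj₂ p))) V₂
      ≈⟨ lsum-cong V₂ (λ { (c₂ , u₂) →
           ≈-trans (linExt-scale⁺ f (c₁ *C c₂) (u₁ ⊛w u₂)) (rescale c₁ c₂ (F u₂)) }) ⟩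
    linExt (λ u₂ → evalC c₁ * F u₂) V₂
      ≈⟨ ≈-sym (linExt-*ˡ (evalC c₁) F V₂) ⟩
    evalC c₁ * linExt F V₂ ∎
    where open ≈-Reasoning

linExt-+ : {X : Set} (f g : X → PS) (V : List (C × X)) → linExt (λ x → f x + g x) V ≈ linExt f V + linExt g V
linExt-+ f g [] = ≈-sym (+-identityˡ 𝟘)
linExt-+ f g ((c , x) ∷ V) = ≈-trans (+-cong (distribˡ (evalC c) (f x) (g x)) (linExt-+ f g V))
  (S.solve 4 (λ A B C D → (A :+ B :+ (C :+ D)) := (A :+ C :+ (B :+ D))) ≈-refl
           (evalC c * f x) (evalC c * g x) (linExt f V) (linExt g V))

linExt-*ʳ : {X : Set} (k : PS) (f : X → PS) (V : List (C × X)) → linExt f V * k ≈ linExt (λ x → f x * k) V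
linExt-*ʳ k f V = ≈-trans (*-comm (linExt f V) k)
  (≈-trans (linExt-*ˡ k f V) (linExt-cong V (λ x → *-comm k (f x))))

weight-∘L : ∀ x y K → linExt (λ l → weight l (suc K)) (x ∘L y) ≈ weight x (suc K) * weight y (suc K)
weight-∘L (z₁₊ a) (z₁₊ b) K = begin
  evalC 1C * tS + (evalC ħ * tS' + 𝟘)
    ≈⟨ +-cong (≈-trans (*-congʳ tS evalC-1) (*-identityˡ tS))
              (≈-trans (+-identityʳ (evalC ħ * tS')) (*-congʳ tS' evalC-ħ)) ⟩
  tS + 1-q * tS'
    ≈⟨ ≈-sym (weight-∘ a b K) ⟩
  weight (z₁₊ a) m * weight (z₁₊ b) m ∎
  where
  open ≈-Reasoning
  m = suc K
  tS = weight (z₁₊ (suc (a +ℕ b))) m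
  tS' = weight (z₁₊ (a +ℕ b)) m

-- t_k(m) A_w(m): the strict nested sum of z_k w with first index m.
aTail⁺ : Word⁺ → ℕ → PS
aTail⁺ (x , w) m = weight x m * aTail w m

-- The terms of A_w(m+1) whose first index equals m.
firstAt : Word → ℕ → PS
firstAt [] m = 𝟘
firstAt (x ∷ w) m = aTail⁺ (x , w) m

aTail-step : ∀ w K → aTail w (suc (suc K)) ≈ aTail w (suc K) + firstAt w (suc K)
aTail-step [] K = ≈-sym (+-identityʳ 𝟙)
aTail-step (z₁₊ a ∷ w) K = ≈-refl

-- A nonempty word has no strictly decreasing indices below 1.
aTail-one : ∀ x w → aTail (x ∷ w) 1 ≈ 𝟘
aTail-one (z₁₊ a) w = ≈-refl

aSum : Lin → ℕ → PS
aSum L m = linExt (λ w → aTail w m) L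

firstSum : Lin → ℕ → PS
firstSum L m = linExt (λ w → firstAt w m) L

aSum-step : ∀ L K → aSum L (suc (suc K)) ≈ aSum L (suc K) + firstSum L (suc K)
aSum-step L K = ≈-trans (linExt-cong L (λ w → aTail-step w K))
                        (linExt-+ (λ w → aTail w (suc K)) (λ w → firstAt w (suc K)) L)

aSum-pre-one : ∀ x L → aSum (pre x L) 1 ≈ 𝟘
aSum-pre-one x L = ≈-trans (linExt-pre (λ w → aTail w 1) x L) (linExt-zero L (aTail-one x))

firstSum-pre : ∀ x L m → firstSum (pre x L) m ≈ weight x m * aSum L m
firstSum-pre x L m = ≈-trans (linExt-pre (λ w → firstAt w m) x L)
                             (≈-sym (linExt-*ˡ (weight x m) (λ w → aTail w m) L))

firstSum-forget : ∀ V m → firstSum (forget V) m ≈ linExt (λ u → aTail⁺ u m) V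
firstSum-forget V m = linExt-forget (λ w → firstAt w m) V

∘act-firstSum : ∀ x L K → linExt (λ u → aTail⁺ u (suc K)) (x ∘act L) ≈ weight x (suc K) * firstSum L (suc K)
∘act-firstSum x L K = begin
  linExt (λ u → aTail⁺ u m) (x ∘act L)   ≈⟨ linExt-∘act (λ u → aTail⁺ u m) x L ⟩
  linExt (onAct (λ u → aTail⁺ u m) x) L  ≈⟨ linExt-cong L pointwise ⟩
  linExt (λ w → weight x m * firstAt w m) L ≈⟨ ≈-sym (linExt-*ˡ (weight x m) (λ w → firstAt w m) L) ⟩
  weight x m * firstSum L m ∎
  where
  open ≈-Reasoning
  m = suc K
  pointwise : ∀ w → onAct (λ u → aTail⁺ u m) x w ≈ weight x m * firstAt w m
  pointwise [] = ≈-sym (zeroʳ (weight x m))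
  pointwise (y ∷ w) = begin
    linExt (λ l → weight l m * aTail w m) (x ∘L y)
      ≈⟨ ≈-sym (linExt-*ʳ (aTail w m) (λ l → weight l m) (x ∘L y)) ⟩
    linExt (λ l → weight l m) (x ∘L y) * aTail w m
      ≈⟨ *-congʳ (aTail w m) (weight-∘L x y K) ⟩
    (weight x m * weight y m) * aTail w m
      ≈⟨ *-assoc (weight x m) (weight y m) (aTail w m) ⟩
    weight x m * (weight y m * aTail w m) ∎

aSum-preComb-one : ∀ ls L → aSum (preComb ls L) 1 ≈ 𝟘
aSum-preComb-one ls L = ≈-trans (linExt-preComb (λ w → aTail w 1) ls L)
  (linExt-zero ls (λ l → linExt-zero L (aTail-one l)))

firstSum-preComb : ∀ ls L m → firstSum (preComb ls L) m ≈ linExt (λ l → weight l m) ls * aSum L m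
firstSum-preComb ls L m = begin
  firstSum (preComb ls L) m
    ≈⟨ linExt-preComb (λ w → firstAt w m) ls L ⟩
  linExt (λ l → linExt (λ w → weight l m * aTail w m) L) ls
    ≈⟨ linExt-cong ls (λ l → ≈-sym (linExt-*ˡ (weight l m) (λ w → aTail w m) L)) ⟩
  linExt (λ l → weight l m * aSum L m) ls
    ≈⟨ ≈-sym (linExt-*ʳ (aSum L m) (λ l → weight l m) ls) ⟩
  linExt (λ l → weight l m) ls * aSum L m ∎
  where open ≈-Reasoning

-- (2) Strict nested sums multiply by the quasi-shuffle product:  A_u A_v = A_{u *₊ v}

-- The three parts of (x u) *₊ (y v) = x (u *₊ y v) + y (x u *₊ v) + (x ∘₊ y)(u *₊ v)
-- carry the first-index terms where the index m belongs to x only, to y only,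
-- or to both.
firstSum-*w : ∀ x u y v K → let m = suc K in
  firstSum ((x ∷ u) *w (y ∷ v)) m
    ≈ weight x m * aSum (u *w (y ∷ v)) m
      + (weight y m * aSum ((x ∷ u) *w v) m + (weight x m * weight y m) * aSum (u *w v) m)
firstSum-*w x u y v K = begin
  firstSum (pre x P₁ ++ pre y P₂ ++ preComb (x ∘L y) P₃) m
    ≈⟨ ≈-trans (lsum-++ first (pre x P₁) (pre y P₂ ++ preComb (x ∘L y) P₃))
               (+-congˡ (firstSum (pre x P₁) m) (lsum-++ first (pre y P₂) (preComb (x ∘L y) P₃))) ⟩
  firstSum (pre x P₁) m + (firstSum (pre y P₂) m + firstSum (preComb (x ∘L y) P₃) m)
    ≈⟨ +-cong (firstSum-pre x P₁ m) (+-cong (firstSum-pre y P₂ m)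
         (≈-trans (firstSum-preComb (x ∘L y) P₃ m) (*-congʳ (aSum P₃ m) (weight-∘L x y K)))) ⟩
  weight x m * aSum P₁ m + (weight y m * aSum P₂ m + (weight x m * weight y m) * aSum P₃ m) ∎
  where
  open ≈-Reasoning
  m = suc K
  first = weigh (λ w → firstAt w m)
  P₁ = u *w (y ∷ v)
  P₂ = (x ∷ u) *w v
  P₃ = u *w v

*w-vanishes-at-one : ∀ x u y v → aSum ((x ∷ u) *w (y ∷ v)) 1 ≈ 𝟘
*w-vanishes-at-one x u y v =
  ≈-trans (lsum-++ strict (pre x P₁) (pre y P₂ ++ preComb (x ∘L y) P₃))
  (≈-trans (+-cong (aSum-pre-one x P₁)
                   (≈-trans (lsum-++ strict (pre y P₂) (preComb (x ∘L y) P₃))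
                            (+-cong (aSum-pre-one y P₂) (aSum-preComb-one (x ∘L y) P₃))))
  (≈-trans (+-identityˡ _) (+-identityˡ 𝟘)))
  where
  strict = weigh (λ w → aTail w 1)
  P₁ = u *w (y ∷ v)
  P₂ = (x ∷ u) *w v
  P₃ = u *w v

-- Induction on m: both sides vanish at m = 1 and have the same increments.
quasiShuffle : ∀ K u v → aTail u (suc K) * aTail v (suc K) ≈ aSum (u *w v) (suc K)
quasiShuffle K [] v = ≈-trans (*-identityˡ (aTail v (suc K))) (≈-sym (linExt-unit (λ w → aTail w (suc K)) v))
quasiShuffle K (x ∷ u) [] =
  ≈-trans (*-identityʳ (aTail (x ∷ u) (suc K))) (≈-sym (linExt-unit (λ w → aTail w (suc K)) (x ∷ u)))
quasiShuffle zero (x ∷ u) (y ∷ v) =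
  ≈-trans (*-cong (aTail-one x u) (aTail-one y v)) (≈-trans (zeroˡ 𝟘) (≈-sym (*w-vanishes-at-one x u y v)))
quasiShuffle (suc K) (x ∷ u) (y ∷ v) = begin
  aTail (x ∷ u) (suc m) * aTail (y ∷ v) (suc m)
    ≈⟨ *-cong (aTail-step (x ∷ u) K) (aTail-step (y ∷ v) K) ⟩
  (Axu + tx * Au) * (Ayv + ty * Av)
    ≈⟨ S.solve 6 (λ Axu Au Ayv Av tx ty → ((Axu :+ tx :* Au) :* (Ayv :+ ty :* Av)) :=
                   (Axu :* Ayv :+ (tx :* (Au :* Ayv) :+ (ty :* (Axu :* Av) :+ (tx :* ty) :* (Au :* Av)))))
               ≈-refl Axu Au Ayv Av tx ty ⟩
  Axu * Ayv + (tx * (Au * Ayv) + (ty * (Axu * Av) + (tx * ty) * (Au * Av)))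
    ≈⟨ +-cong (quasiShuffle K (x ∷ u) (y ∷ v))
              (+-cong (*-congˡ tx (quasiShuffle K u (y ∷ v)))
                      (+-cong (*-congˡ ty (quasiShuffle K (x ∷ u) v)) (*-congˡ (tx * ty) (quasiShuffle K u v)))) ⟩
  aSum L m + (tx * aSum (u *w (y ∷ v)) m + (ty * aSum ((x ∷ u) *w v) m + (tx * ty) * aSum (u *w v) m))
    ≈⟨ +-congˡ (aSum L m) (≈-sym (firstSum-*w x u y v K)) ⟩
  aSum L m + firstSum L m
    ≈⟨ ≈-sym (aSum-step L K) ⟩
  aSum L (suc m) ∎
  where
  open ≈-Reasoning
  m = suc K
  L = (x ∷ u) *w (y ∷ v)
  tx = weight x m
  ty = weight y m
  Axu = aTail (x ∷ u) m
  Ayv = aTail (y ∷ v) m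
  Au = aTail u m
  Av = aTail v m

-- (3) d_q turns weak nested sums into strict ones:  S_w(M) = A_{d_q w}(M+1)

-- d_q(z_k w) = z_k d_q(w) + z_k ∘₊ d_q(w): the first index m either stays strictly
-- above the rest (first part) or merges with the next index (second part), so
-- the strict sum of d_q(z_k w) at m is t_k(m) (A + first-index terms of d_q w)(m).
strict-dW⁺ : ∀ x w K → let m = suc K in
  linExt (λ u → aTail⁺ u m) (dW⁺ (x , w)) ≈ weight x m * (aSum (dW w) m + firstSum (dW w) m)
strict-dW⁺ x w K = begin
  linExt strict (pre⁺ x D ++ x ∘act D)
    ≈⟨ lsum-++ (weigh strict) (pre⁺ x D) (x ∘act D) ⟩
  linExt strict (pre⁺ x D) + linExt strict (x ∘act D)
    ≈⟨ +-cong (≈-trans (linExt-pre⁺ strict x D) (≈-sym (linExt-*ˡ (weight x m) (λ w → aTail w m) D)))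
              (∘act-firstSum x D K) ⟩
  weight x m * aSum D m + weight x m * firstSum D m
    ≈⟨ ≈-sym (distribˡ (weight x m) (aSum D m) (firstSum D m)) ⟩
  weight x m * (aSum D m + firstSum D m) ∎
  where
  open ≈-Reasoning
  m = suc K
  strict = λ u → aTail⁺ u m
  D = dW w

firstSum-dW : ∀ x w m → firstSum (dW (x ∷ w)) m ≈ linExt (λ u → aTail⁺ u m) (dW⁺ (x , w))
firstSum-dW x w m =
  ≈-trans (lsum-++ (weigh (λ w → firstAt w m)) (pre x D) (forget (x ∘act D)))
  (≈-trans (+-cong (≈-trans (linExt-pre (λ w → firstAt w m) x D) (≈-sym (linExt-pre⁺ strict x D)))
                   (firstSum-forget (x ∘act D) m))
           (≈-sym (lsum-++ (weigh strict) (pre⁺ x D) (x ∘act D))))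
  where
  strict = λ u → aTail⁺ u m
  D = dW w

dW-vanishes-at-one : ∀ x w → aSum (dW (x ∷ w)) 1 ≈ 𝟘
dW-vanishes-at-one x w =
  ≈-trans (lsum-++ (weigh (λ w → aTail w 1)) (pre x D) (forget (x ∘act D)))
  (≈-trans (+-cong (aSum-pre-one x D)
                   (≈-trans (linExt-forget (λ w → aTail w 1) (x ∘act D))
                            (linExt-zero (x ∘act D) (λ u → aTail-one (proj₁ u) (proj₂ u)))))
           (+-identityˡ 𝟘))
  where D = dW w

-- Induction on M: both sides vanish at M = 0 and have the same increments.
weak-to-strict : ∀ w M → sTail w M ≈ aSum (dW w) (suc M)
weak-to-strict [] M = ≈-sym (linExt-unit (λ w → aTail w (suc M)) [])
weak-to-strict (z₁₊ a ∷ w) zero = ≈-sym (dW-vanishes-at-one (z₁₊ a) w)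
weak-to-strict (z₁₊ a ∷ w) (suc M) = begin
  sTail (x ∷ w) M + tx * sTail w m
    ≈⟨ +-cong (weak-to-strict (z₁₊ a ∷ w) M) (*-congˡ tx (weak-to-strict w (suc M))) ⟩
  aSum (dW (x ∷ w)) m + tx * aSum D (suc m)
    ≈⟨ +-congˡ (aSum (dW (x ∷ w)) m) (*-congˡ tx (aSum-step D M)) ⟩
  aSum (dW (x ∷ w)) m + tx * (aSum D m + firstSum D m)
    ≈⟨ +-congˡ (aSum (dW (x ∷ w)) m) (≈-sym (≈-trans (firstSum-dW x w m) (strict-dW⁺ x w M))) ⟩
  aSum (dW (x ∷ w)) m + firstSum (dW (x ∷ w)) m
    ≈⟨ ≈-sym (aSum-step (dW (x ∷ w)) M) ⟩
  aSum (dW (x ∷ w)) (suc m) ∎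
  where
  open ≈-Reasoning
  x = z₁₊ a
  m = suc M
  tx = weight x m
  D = dW w

strict-dq-word : ∀ x w K → linExt (λ u → aTail⁺ u (suc K)) (dW⁺ (x , w)) ≈ weight x (suc K) * sTail w (suc K)
strict-dq-word x w K = ≈-trans (strict-dW⁺ x w K)
  (*-congˡ (weight x (suc K)) (≈-sym (≈-trans (weak-to-strict w (suc K)) (aSum-step (dW w) K))))

-- (4) The maps a and s.

-- a(V)(n) is the strict sum of V with first index n + 1.
a-linExt : ∀ V n → a V n ≈ linExt (λ u → aTail⁺ u (suc n)) V
a-linExt [] n = ≈-refl
a-linExt ((c , (z₁₊ k , w)) ∷ V) n = +-congˡ (evalC c * aW (z₁₊ k , w) n) (a-linExt V n)

s-linExt : ∀ V n → s V n ≈ linExt (λ u → sW u n) V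
s-linExt [] n = ≈-refl
s-linExt ((c , u) ∷ V) n = +-congˡ (evalC c * sW u n) (s-linExt V n)

-- On words:  A_{(z_i w₁) ⊛_q (z_j w₂)}(m) = q^m (t_i A_{w₁})(m) (t_j A_{w₂})(m),  by (1) and (2).
strict-⊛w : ∀ u₁ u₂ K → let m = suc K in
  linExt (λ u → aTail⁺ u m) (u₁ ⊛w u₂) ≈ qPow m * (aTail⁺ u₁ m * aTail⁺ u₂ m)
strict-⊛w (z₁₊ i , w₁) (z₁₊ j , w₂) K = begin
  linExt (λ u → aTail⁺ u m) (pre⁺ (z₁₊ (suc (i +ℕ j))) (w₁ *w w₂))
    ≈⟨ linExt-pre⁺ (λ u → aTail⁺ u m) (z₁₊ (suc (i +ℕ j))) (w₁ *w w₂) ⟩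
  linExt (λ w → weight (z₁₊ (suc (i +ℕ j))) m * aTail w m) (w₁ *w w₂)
    ≈⟨ ≈-sym (linExt-*ˡ (weight (z₁₊ (suc (i +ℕ j))) m) (λ w → aTail w m) (w₁ *w w₂)) ⟩
  weight (z₁₊ (suc (i +ℕ j))) m * aSum (w₁ *w w₂) m
    ≈⟨ *-cong (weight-⊛ i j m) (≈-sym (quasiShuffle K w₁ w₂)) ⟩
  (Q * (tᵢ * tⱼ)) * (A₁ * A₂)
    ≈⟨ S.solve 5 (λ Q tᵢ tⱼ A₁ A₂ → ((Q :* (tᵢ :* tⱼ)) :* (A₁ :* A₂))
                                   := (Q :* ((tᵢ :* A₁) :* (tⱼ :* A₂))))
                 ≈-refl Q tᵢ tⱼ A₁ A₂ ⟩
  Q * ((tᵢ * A₁) * (tⱼ * A₂)) ∎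
  where
  open ≈-Reasoning
  m = suc K
  Q = qPow m
  tᵢ = weight (z₁₊ i) m
  tⱼ = weight (z₁₊ j) m
  A₁ = aTail w₁ m
  A₂ = aTail w₂ m

a-⊛ : ∀ V₁ V₂ n → a (V₁ ⊛ V₂) n ≈ qPow (suc n) * (a V₁ n * a V₂ n)
a-⊛ V₁ V₂ n = begin
  a (V₁ ⊛ V₂) n
    ≈⟨ a-linExt (V₁ ⊛ V₂) n ⟩
  linExt A (V₁ ⊛ V₂)
    ≈⟨ linExt-⊛ A V₁ V₂ ⟩
  linExt (λ u₁ → linExt (λ u₂ → linExt A (u₁ ⊛w u₂)) V₂) V₁
    ≈⟨ linExt-cong V₁ row ⟩
  linExt (λ u₁ → (Q * A u₁) * linExt A V₂) V₁
    ≈⟨ ≈-sym (linExt-*ʳ (linExt A V₂) (λ u₁ → Q * A u₁) V₁) ⟩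
  linExt (λ u₁ → Q * A u₁) V₁ * linExt A V₂
    ≈⟨ *-congʳ (linExt A V₂) (≈-sym (linExt-*ˡ Q A V₁)) ⟩
  (Q * linExt A V₁) * linExt A V₂
    ≈⟨ *-assoc Q (linExt A V₁) (linExt A V₂) ⟩
  Q * (linExt A V₁ * linExt A V₂)
    ≈⟨ *-congˡ Q (≈-sym (*-cong (a-linExt V₁ n) (a-linExt V₂ n))) ⟩
  Q * (a V₁ n * a V₂ n) ∎
  where
  open ≈-Reasoning
  Q = qPow (suc n)
  A = λ u → aTail⁺ u (suc n)
  row : ∀ u₁ → linExt (λ u₂ → linExt A (u₁ ⊛w u₂)) V₂ ≈ (Q * A u₁) * linExt A V₂
  row u₁ = ≈-trans (linExt-cong V₂ (λ u₂ → ≈-trans (strict-⊛w u₁ u₂ n) (≈-sym (*-assoc Q (A u₁) (A u₂)))))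
                   (≈-sym (linExt-*ˡ (Q * A u₁) A V₂))

-- s(V)(n) = q^{n+1} a(d_q V)(n),  by (3) and linearity of d_q.
s-dq : ∀ V n → s V n ≈ qPow (suc n) * a (dq V) n
s-dq V n = begin
  s V n                                          ≈⟨ s-linExt V n ⟩
  linExt (λ u → sW u n) V                        ≈⟨ linExt-cong V on-word ⟩
  linExt (λ u → Q * linExt A (dW⁺ u)) V          ≈⟨ ≈-sym (linExt-*ˡ Q (λ u → linExt A (dW⁺ u)) V) ⟩
  Q * linExt (λ u → linExt A (dW⁺ u)) V          ≈⟨ *-congˡ Q (≈-sym (linExt-dq A V)) ⟩
  Q * linExt A (dq V)                            ≈⟨ *-congˡ Q (≈-sym (a-linExt (dq V) n)) ⟩
  Q * a (dq V) n                                 ∎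
  where
  open ≈-Reasoning
  m = suc n
  Q = qPow m
  A = λ u → aTail⁺ u m
  on-word : ∀ u → sW u n ≈ Q * linExt A (dW⁺ u)
  on-word (z₁₊ k , w) = begin
    qfrac (suc k *ℕ m) m (suc k) * sTail w m       ≈⟨ *-congʳ (sTail w m) (s-leading k m) ⟩
    (Q * weight (z₁₊ k) m) * sTail w m             ≈⟨ *-assoc Q (weight (z₁₊ k) m) (sTail w m) ⟩
    Q * (weight (z₁₊ k) m * sTail w m)             ≈⟨ *-congˡ Q (≈-sym (strict-dq-word (z₁₊ k) w n)) ⟩
    Q * linExt A (dW⁺ (z₁₊ k , w))                 ∎

proposition2p7 : (w₁ w₂ : Lin⁺) (n k : ℕ) →
    (s w₁ n *ₛ a w₂ n) k ≡ a (dq w₁ ⊛ w₂) n k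
proposition2p7 w₁ w₂ n = app (begin
  s w₁ n * a w₂ n                    ≈⟨ *-congʳ (a w₂ n) (s-dq w₁ n) ⟩
  (Q * a (dq w₁) n) * a w₂ n         ≈⟨ *-assoc Q (a (dq w₁) n) (a w₂ n) ⟩
  Q * (a (dq w₁) n * a w₂ n)         ≈⟨ ≈-sym (a-⊛ (dq w₁) w₂ n) ⟩
  a (dq w₁ ⊛ w₂) n                   ∎)
  where
  open ≈-Reasoning
  Q = qPow (suc n)
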